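{- (a) For any permutation $\pi$ of length $n\ge1$, $1\le\mathrm{udr}(\pi)\le n$; moreover, if $\mathrm{udr}(\pi)=1$ then $\mathrm{des}(\pi)=0$, and otherwise $\lfloor\mathrm{udr}(\pi)/2\rfloor\le\mathrm{des}(\pi)\le n-\lceil\mathrm{udr}(\pi)/2\rceil$. (b) If $n\ge1$, $2\le j\le n$ and $\lfloor j/2\rfloor\le k\le n-\lceil j/2\rceil$, then there exists a permutation $\pi$ of length $n$ with $\mathrm{udr}(\pi)=j$ and $\mathrm{des}(\pi)=k$. In addition, for every $n\ge1$ there exists a permutation $\pi$ of length $n$ with $\mathrm{udr}(\pi)=1$ and $\mathrm{des}(\pi)=0$.
   Context: A permutation of length $n$ is a sequence $\pi=\pi_1\cdots\pi_n$ of distinct positive integers. $\mathrm{des}(\pi)$ is the number of $i\in[n-1]$ with $\pi_i>\pi_{i+1}$. A birun of $\pi$ is a maximal monotone consecutive subsequence; an up-down run of $\pi$ is either a birun or the single letter $\pi_1$ when $\pi_1>\pi_2$; $\mathrm{udr}(\pi)$ is the number of up-down runs. -}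

module Defs where

open import Data.Nat using (ℕ; zero; suc; _+_; _∸_; _<_; _<ᵇ_; _≡ᵇ_)
open import Data.Bool using (Bool; true; false; _∧_; _∨_; not; if_then_else_)
open import Data.List using (List; []; _∷_; length; take; drop; upTo; filter; concatMap; map)
open import Data.List.Relation.Unary.All using (All)
open import Data.List.Relation.Unary.Unique.Propositional using (Unique)
open import Data.Product using (_×_; _,_)
open import Relation.Binary.PropositionalEquality using (_≡_)

IsPerm : ℕ → List ℕ → Set
IsPerm n π = (length π ≡ n) × (Unique π × All (λ x → 0 < x) π)

des : List ℕ → ℕ
des [] = 0
des (x ∷ []) = 0
des (x ∷ y ∷ xs) = (if y <ᵇ x then 1 else 0) + des (y ∷ xs)

incr : List ℕ → Bool
incr [] = true
incr (x ∷ []) = true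
incr (x ∷ y ∷ xs) = (x <ᵇ y) ∧ incr (y ∷ xs)

decr : List ℕ → Bool
decr [] = true
decr (x ∷ []) = true
decr (x ∷ y ∷ xs) = (y <ᵇ x) ∧ decr (y ∷ xs)

monotone : List ℕ → Bool
monotone s = incr s ∨ decr s

-- consecutive segment π_i ... π_j (0-indexed, i ≤ j)
seg : List ℕ → ℕ → ℕ → List ℕ
seg π i j = take (suc j ∸ i) (drop i π)

-- [i, j] (0-indexed, i ≤ j < length π) is a birun: monotone and maximal
-- (cannot be extended to the left or to the right while staying monotone)
isBirun : List ℕ → ℕ → ℕ → Bool
isBirun π zero j =
  monotone (seg π zero j) ∧ not ((suc j <ᵇ length π) ∧ monotone (seg π zero (suc j)))
isBirun π (suc i) j =
  monotone (seg π (suc i) j)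
  ∧ not (monotone (seg π i j))
  ∧ not ((suc j <ᵇ length π) ∧ monotone (seg π (suc i) (suc j)))

intervals : ℕ → List (ℕ × ℕ)
intervals n = concatMap (λ j → map (λ i → (i , j)) (upTo (suc j))) (upTo n)

count : {A : Set} → (A → Bool) → List A → ℕ
count p [] = 0
count p (x ∷ xs) = (if p x then 1 else 0) + count p xs

biruns : List ℕ → ℕ
biruns π = count (λ { (i , j) → isBirun π i j }) (intervals (length π))

firstDesc : List ℕ → ℕ
firstDesc (x ∷ y ∷ xs) = if y <ᵇ x then 1 else 0
firstDesc _ = 0

udr : List ℕ → ℕ
udr π = biruns π + firstDesc π

module Submission where

-- Everything goes through the descent word w of a list π, whose i-th letter records
-- whether π has a descent at position i.  If adjacent entries of π are distinct,
--   des π = occ true w   and   udr π = 1 + changes false w,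
-- where changes false w counts letter changes of false·w (the leading ascent makes
-- an initial descent an extra up-down run).  The udr formula is the heart: summing
-- isBirun over the triangle of intervals column by column, exactly one birun starts
-- at position 0, and one starts at position 1 iff the direction changes there, so
--   biruns (x ∷ y ∷ z ∷ r) = [direction changes at y] + biruns (y ∷ z ∷ r).
-- Part (a) then reduces to inequalities between letter changes and letter counts of
-- a Boolean word.  For parts (b) and (c) every Boolean word w is the descent word of
-- a permutation of 1 … |w|+1 (realise), applied to the staircase words
-- false^a true^(e+1) (false true false …) and to false^m.

open import Defs
open import Algebra.Properties.CommutativeSemigroup using (interchange)
open import Data.Bool using (Bool; true; false; not; _∧_; _xor_; if_then_else_)
open import Data.Bool.Properties using (∨-zeroʳ)
open import Data.Empty using (⊥-elim)
open import Data.Nat using (ℕ; zero; suc; _+_; _∸_; _<_; _≤_; _<ᵇ_; z≤n; s≤s; ⌊_/2⌋; ⌈_/2⌉)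
open import Data.Nat.Properties
  using ( ≤-refl; ≤-trans; ≤-reflexive; n≤1+n; m≤n+m; +-mono-≤; +-assoc; +-comm; +-suc
        ; +-identityʳ; +-∸-comm; m∸n+n≡m; suc-injective; <⇒≢
        ; ⌊n/2⌋-mono; ⌈n/2⌉-mono; n≡⌈n+n/2⌉; ⌊n/2⌋+⌈n/2⌉≡n; ⌈n/2⌉≤n
        ; m≤n⇒∃[o]m+o≡n; +-commutativeSemigroup; module ≤-Reasoning )
open import Data.List using (List; []; _∷_; length; take; map; applyUpTo; concatMap; replicate; _++_)
open import Data.List.Properties using (length-map; length-++; length-replicate; ++-identityʳ)
open import Data.List.Relation.Unary.All using (All; []; _∷_)
import Data.List.Relation.Unary.All as All
import Data.List.Relation.Unary.All.Properties as AllP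
open import Data.List.Relation.Unary.AllPairs using ([]; _∷_)
open import Data.List.Relation.Unary.Linked using (Linked; _∷_)
open import Data.List.Relation.Unary.Linked.Properties using (AllPairs⇒Linked)
open import Data.List.Relation.Unary.Unique.Propositional using (Unique)
import Data.List.Relation.Unary.Unique.Propositional.Properties as Unique
open import Data.Product using (Σ; _×_; _,_; proj₁)
open import Function using (_∘_)
open import Relation.Binary.PropositionalEquality

ind : Bool → ℕ
ind c = if c then 1 else 0

ind≤1 : ∀ c → ind c ≤ 1
ind≤1 true = ≤-refl
ind≤1 false = z≤n

∑ : (ℕ → ℕ) → ℕ → ℕ
∑ f zero = 0
∑ f (suc n) = f 0 + ∑ (f ∘ suc) n

∑-cong : ∀ {f g} n → (∀ i → f i ≡ g i) → ∑ f n ≡ ∑ g n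
∑-cong zero f≡g = refl
∑-cong (suc n) f≡g = cong₂ _+_ (f≡g 0) (∑-cong n (f≡g ∘ suc))

∑-zero : ∀ {f} n → (∀ i → f i ≡ 0) → ∑ f n ≡ 0
∑-zero zero f≡0 = refl
∑-zero (suc n) f≡0 rewrite f≡0 0 = ∑-zero n (f≡0 ∘ suc)

∑-+ : ∀ f g n → ∑ (λ i → f i + g i) n ≡ ∑ f n + ∑ g n
∑-+ f g zero = refl
∑-+ f g (suc n) =
  trans (cong (f 0 + g 0 +_) (∑-+ (f ∘ suc) (g ∘ suc) n))
        (interchange +-commutativeSemigroup (f 0) (g 0) _ _)

count-++ : ∀ {A : Set} (p : A → Bool) xs ys → count p (xs ++ ys) ≡ count p xs + count p ys
count-++ p [] ys = refl
count-++ p (x ∷ xs) ys = trans (cong (ind (p x) +_) (count-++ p xs ys)) (sym (+-assoc (ind (p x)) _ _))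

count-map-applyUpTo : ∀ {A : Set} (p : A → Bool) (f : ℕ → A) (g : ℕ → ℕ) n →
  count p (map f (applyUpTo g n)) ≡ ∑ (λ i → ind (p (f (g i)))) n
count-map-applyUpTo p f g zero = refl
count-map-applyUpTo p f g (suc n) = cong (ind (p (f (g 0))) +_) (count-map-applyUpTo p f (g ∘ suc) n)

count-concatMap-applyUpTo : ∀ {A : Set} (p : A → Bool) (f : ℕ → List A) (g : ℕ → ℕ) n →
  count p (concatMap f (applyUpTo g n)) ≡ ∑ (λ j → count p (f (g j))) n
count-concatMap-applyUpTo p f g zero = refl
count-concatMap-applyUpTo p f g (suc n) =
  trans (count-++ p (f (g 0)) _) (cong (count p (f (g 0)) +_) (count-concatMap-applyUpTo p f (g ∘ suc) n))

triangle : (ℕ → ℕ → Bool) → ℕ → ℕ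
triangle q n = ∑ (λ j → ∑ (λ i → ind (q i j)) (suc j)) n

count-intervals : ∀ (p : ℕ × ℕ → Bool) n → count p (intervals n) ≡ triangle (λ i j → p (i , j)) n
count-intervals p n =
  trans (count-concatMap-applyUpTo p _ (λ j → j) n)
        (∑-cong n (λ j → count-map-applyUpTo p (λ i → (i , j)) (λ i → i) (suc j)))

triangle-peel : ∀ q n →
  triangle q (suc n) ≡ ∑ (λ j → ind (q 0 j)) (suc n) + triangle (λ i j → q (suc i) (suc j)) n
triangle-peel q n = begin
  (a + 0) + ∑ (λ j → c j + d j) n  ≡⟨ cong₂ _+_ (+-identityʳ a) (∑-+ c d n) ⟩
  a + (∑ c n + ∑ d n)              ≡⟨ sym (+-assoc a _ _) ⟩
  a + ∑ c n + ∑ d n                ∎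
  where
  open ≡-Reasoning
  a : ℕ
  a = ind (q 0 0)
  c d : ℕ → ℕ
  c j = ind (q 0 (suc j))
  d j = ∑ (λ i → ind (q (suc i) (suc j))) (suc j)

∧-mapʳ : ∀ a {b c} → (b ≡ true → c ≡ true) → a ∧ b ≡ true → a ∧ c ≡ true
∧-mapʳ true b⇒c a∧b = b⇒c a∧b

incr-take : ∀ k l → incr (take (suc k) l) ≡ true → incr (take k l) ≡ true
incr-take zero l h = refl
incr-take (suc k) [] h = refl
incr-take (suc zero) (x ∷ l) h = refl
incr-take (suc (suc k)) (x ∷ []) h = refl
incr-take (suc (suc k)) (x ∷ y ∷ l) = ∧-mapʳ (x <ᵇ y) (incr-take (suc k) (y ∷ l))

decr-take : ∀ k l → decr (take (suc k) l) ≡ true → decr (take k l) ≡ true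
decr-take zero l h = refl
decr-take (suc k) [] h = refl
decr-take (suc zero) (x ∷ l) h = refl
decr-take (suc (suc k)) (x ∷ []) h = refl
decr-take (suc (suc k)) (x ∷ y ∷ l) = ∧-mapʳ (y <ᵇ x) (decr-take (suc k) (y ∷ l))

monotone-take : ∀ k l → monotone (take (suc k) l) ≡ true → monotone (take k l) ≡ true
monotone-take k l h with incr (take (suc k) l) in up | decr (take (suc k) l) in down
... | true | _ rewrite incr-take k l up = refl
... | false | true rewrite decr-take k l down = ∨-zeroʳ _

-- A downward closed predicate g with g 0 has exactly one maximal element below
-- N = suc n: exactly one j < N has g j but not (j + 1 < N and g (j + 1)).
one-maximal : ∀ (g : ℕ → Bool) n → g 0 ≡ true → (∀ k → g (suc k) ≡ true → g k ≡ true) →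
  ∑ (λ j → ind (g j ∧ not ((suc j <ᵇ suc n) ∧ g (suc j)))) (suc n) ≡ 1
one-maximal g zero g0 closed rewrite g0 = refl
one-maximal g (suc n) g0 closed =
  trans (cong (λ u → ind (u ∧ not (g 1)) + later) g0) (by-g1 (g 1) refl)
  where
  after : ℕ → Bool
  after j = (suc j <ᵇ suc n) ∧ g (suc (suc j))
  later : ℕ
  later = ∑ (λ j → ind (g (suc j) ∧ not (after j))) (suc n)
  beyond : g 1 ≡ false → ∀ j → g (suc j) ≡ false
  beyond g1 zero = g1
  beyond g1 (suc j) with g (suc (suc j)) in gj
  ... | false = refl
  ... | true with trans (sym (beyond g1 j)) (closed (suc j) gj)
  ...   | ()
  -- j = 0 is maximal iff g 1 fails; otherwise the maximal element lies beyond 0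
  by-g1 : ∀ v → g 1 ≡ v → ind (not v) + later ≡ 1
  by-g1 true g1 = one-maximal (g ∘ suc) n g1 (closed ∘ suc)
  by-g1 false g1 = cong suc (∑-zero (suc n) (λ j → cong (λ v → ind (v ∧ not (after j))) (beyond g1 j)))

biruns-triangle : ∀ π → biruns π ≡ triangle (isBirun π) (length π)
biruns-triangle π = count-intervals _ (length π)

-- Exactly one birun starts at position 0: the longest monotone prefix.
biruns-from-0 : ∀ x l → ∑ (λ j → ind (isBirun (x ∷ l) 0 j)) (length (x ∷ l)) ≡ 1
biruns-from-0 x l =
  one-maximal (λ j → monotone (take (suc j) (x ∷ l))) (length l) refl
              (λ k → monotone-take (suc k) (x ∷ l))

biruns-cons : ∀ x l →
  biruns (x ∷ l) ≡ 1 + triangle (λ i j → isBirun (x ∷ l) (suc i) (suc j)) (length l)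
biruns-cons x l =
  trans (biruns-triangle (x ∷ l))
        (trans (triangle-peel (isBirun (x ∷ l)) (length l)) (cong (_+ shifted) (biruns-from-0 x l)))
  where
  shifted : ℕ
  shifted = triangle (λ i j → isBirun (x ∷ l) (suc i) (suc j)) (length l)

<ᵇ-flip : ∀ x y → x ≢ y → (x <ᵇ y) ≡ not (y <ᵇ x)
<ᵇ-flip zero zero x≢y = ⊥-elim (x≢y refl)
<ᵇ-flip zero (suc y) x≢y = refl
<ᵇ-flip (suc x) zero x≢y = refl
<ᵇ-flip (suc x) (suc y) x≢y = <ᵇ-flip x y (x≢y ∘ cong suc)

monotone-pair : ∀ x y → x ≢ y → monotone (x ∷ y ∷ []) ≡ true
monotone-pair x y x≢y rewrite <ᵇ-flip x y x≢y with y <ᵇ x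
... | true = refl
... | false = refl

monotone-cons : ∀ x y z t → x ≢ y → y ≢ z →
  monotone (x ∷ y ∷ z ∷ t) ≡ not ((y <ᵇ x) xor (z <ᵇ y)) ∧ monotone (y ∷ z ∷ t)
monotone-cons x y z t x≢y y≢z rewrite <ᵇ-flip x y x≢y | <ᵇ-flip y z y≢z with y <ᵇ x | z <ᵇ y
... | true | true = refl
... | true | false = refl
... | false | true = refl
... | false | false = refl

absorb : ∀ g s c → g ∧ not (not s ∧ g) ∧ c ≡ s ∧ (g ∧ c)
absorb true true c = refl
absorb true false c = refl
absorb false true c = refl
absorb false false c = refl

biruns-from-1 : ∀ x y z r → x ≢ y → y ≢ z →
  ∑ (λ j → ind (isBirun (x ∷ y ∷ z ∷ r) 1 (suc j))) (suc (suc (length r)))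
    ≡ ind ((y <ᵇ x) xor (z <ᵇ y))
biruns-from-1 x y z r x≢y y≢z rewrite monotone-pair x y x≢y =
  trans (∑-cong (suc (length r)) starts-at-1) (count-maximal s)
  where
  s : Bool
  s = (y <ᵇ x) xor (z <ᵇ y)
  run : ℕ → Bool
  run j = monotone (y ∷ z ∷ take j r)
  maximal : ℕ → Bool
  maximal j = run j ∧ not ((suc j <ᵇ suc (length r)) ∧ run (suc j))
  starts-at-1 : ∀ j → ind (isBirun (x ∷ y ∷ z ∷ r) 1 (suc (suc j))) ≡ ind (s ∧ maximal j)
  starts-at-1 j rewrite monotone-cons x y z (take j r) x≢y y≢z = cong ind (absorb (run j) s _)
  count-maximal : ∀ s → ∑ (λ j → ind (s ∧ maximal j)) (suc (length r)) ≡ ind s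
  count-maximal false = ∑-zero (suc (length r)) (λ j → refl)
  count-maximal true =
    one-maximal run (length r) (monotone-pair y z y≢z) (λ k → monotone-take (suc (suc k)) (y ∷ z ∷ r))

biruns-step : ∀ x y z r → x ≢ y → y ≢ z →
  biruns (x ∷ y ∷ z ∷ r) ≡ ind ((y <ᵇ x) xor (z <ᵇ y)) + biruns (y ∷ z ∷ r)
biruns-step x y z r x≢y y≢z = begin
  biruns (x ∷ y ∷ z ∷ r)             ≡⟨ biruns-cons x (y ∷ z ∷ r) ⟩
  1 + triangle shifted (suc (suc n)) ≡⟨ cong (1 +_) (triangle-peel shifted (suc n)) ⟩
  1 + (from-1 + rest)                ≡⟨ cong (λ v → 1 + (v + rest)) (biruns-from-1 x y z r x≢y y≢z) ⟩
  1 + (s + rest)                     ≡⟨ sym (+-suc s rest) ⟩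
  s + (1 + rest)                     ≡⟨ cong (s +_) (sym (biruns-cons y (z ∷ r))) ⟩
  s + biruns (y ∷ z ∷ r)             ∎
  where
  open ≡-Reasoning
  n s from-1 rest : ℕ
  n = length r
  s = ind ((y <ᵇ x) xor (z <ᵇ y))
  shifted : ℕ → ℕ → Bool
  shifted i j = isBirun (x ∷ y ∷ z ∷ r) (suc i) (suc j)
  from-1 = ∑ (λ j → ind (isBirun (x ∷ y ∷ z ∷ r) 1 (suc j))) (suc (suc n))
  rest = triangle (λ i j → isBirun (y ∷ z ∷ r) (suc i) (suc j)) (suc n)

descentWord : List ℕ → List Bool
descentWord (x ∷ y ∷ r) = (y <ᵇ x) ∷ descentWord (y ∷ r)
descentWord _ = []

descentWord-length : ∀ π → 1 ≤ length π → suc (length (descentWord π)) ≡ length π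
descentWord-length (x ∷ []) _ = refl
descentWord-length (x ∷ y ∷ r) _ = cong suc (descentWord-length (y ∷ r) (s≤s z≤n))

_==_ : Bool → Bool → Bool
true == v = v
false == v = not v

occ : Bool → List Bool → ℕ
occ c = count (c ==_)

changes : Bool → List Bool → ℕ
changes p [] = 0
changes p (c ∷ w) = ind (p xor c) + changes c w

des-descentWord : ∀ π → des π ≡ occ true (descentWord π)
des-descentWord [] = refl
des-descentWord (x ∷ []) = refl
des-descentWord (x ∷ y ∷ r) = cong (ind (y <ᵇ x) +_) (des-descentWord (y ∷ r))

-- A pair is a single birun, and every direction change adds one.
-- (Adjacent entries must differ: equal neighbours would be neither ascent nor descent.)
biruns-descentWord : ∀ x y r → Linked _≢_ (x ∷ y ∷ r) →
  biruns (x ∷ y ∷ r) ≡ suc (changes (y <ᵇ x) (descentWord (y ∷ r)))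
biruns-descentWord x y [] (x≢y ∷ _) rewrite <ᵇ-flip x y x≢y with y <ᵇ x
... | true = refl
... | false = refl
biruns-descentWord x y (z ∷ r) (x≢y ∷ adjacent@(y≢z ∷ _)) = begin
  biruns (x ∷ y ∷ z ∷ r)                          ≡⟨ biruns-step x y z r x≢y y≢z ⟩
  s + biruns (y ∷ z ∷ r)                          ≡⟨ cong (s +_) (biruns-descentWord y z r adjacent) ⟩
  s + suc (changes (z <ᵇ y) (descentWord (z ∷ r))) ≡⟨ +-suc s _ ⟩
  suc (changes (y <ᵇ x) (descentWord (y ∷ z ∷ r))) ∎
  where
  open ≡-Reasoning
  s : ℕ
  s = ind ((y <ᵇ x) xor (z <ᵇ y))

udr-descentWord : ∀ π → Linked _≢_ π → 1 ≤ length π → udr π ≡ suc (changes false (descentWord π))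
udr-descentWord (x ∷ []) _ _ = refl
udr-descentWord (x ∷ y ∷ r) adjacent _ rewrite biruns-descentWord x y r adjacent with y <ᵇ x
... | true = cong suc (+-comm _ 1)
... | false = cong suc (+-identityʳ _)

changes-≤-length : ∀ p w → changes p w ≤ length w
changes-≤-length p [] = z≤n
changes-≤-length p (c ∷ w) = +-mono-≤ (ind≤1 (p xor c)) (changes-≤-length c w)

-- Each change of p·w enters or leaves a block of the letter not p, so there are at
-- most twice as many changes as letters not p; blocks of p allow one change more.
mutual
  changes-≤-other : ∀ p w → changes p w ≤ occ (not p) w + occ (not p) w
  changes-≤-other p [] = z≤n
  changes-≤-other true (true ∷ w) = changes-≤-other true w
  changes-≤-other false (false ∷ w) = changes-≤-other false w
  changes-≤-other true (false ∷ w) =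
    s≤s (≤-trans (changes-≤-same false w) (≤-reflexive (sym (+-suc (occ false w) _))))
  changes-≤-other false (true ∷ w) =
    s≤s (≤-trans (changes-≤-same true w) (≤-reflexive (sym (+-suc (occ true w) _))))

  changes-≤-same : ∀ p w → changes p w ≤ suc (occ p w + occ p w)
  changes-≤-same p [] = z≤n
  changes-≤-same true (true ∷ w) =
    ≤-trans (changes-≤-same true w) (s≤s (+-mono-≤ (n≤1+n _) (n≤1+n _)))
  changes-≤-same false (false ∷ w) =
    ≤-trans (changes-≤-same false w) (s≤s (+-mono-≤ (n≤1+n _) (n≤1+n _)))
  changes-≤-same true (false ∷ w) = s≤s (changes-≤-other false w)
  changes-≤-same false (true ∷ w) = s≤s (changes-≤-other true w)

changes-zero : ∀ w → changes false w ≡ 0 → occ true w ≡ 0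
changes-zero [] _ = refl
changes-zero (false ∷ w) h = changes-zero w h

occ-length : ∀ w → occ false w + occ true w ≡ length w
occ-length [] = refl
occ-length (false ∷ w) = cong suc (occ-length w)
occ-length (true ∷ w) = trans (+-suc (occ false w) _) (cong suc (occ-length w))

Admissible : ℕ → ℕ → ℕ → Set
Admissible n u d =
  (1 ≤ u) × (u ≤ n) × (u ≡ 1 → d ≡ 0) × (u ≢ 1 → (⌊ u /2⌋ ≤ d) × (d ≤ n ∸ ⌈ u /2⌉))

word-admissible : ∀ w → Admissible (suc (length w)) (suc (changes false w)) (occ true w)
word-admissible w =
  s≤s z≤n , s≤s (changes-≤-length false w) , changes-zero w ∘ suc-injective
  , λ _ → lower , upper
  where
  open ≤-Reasoning
  c : ℕ
  c = changes false w
  -- ⌊ (1 + c) / 2 ⌋ = ⌈ c / 2 ⌉ ≤ occ true w, since c ≤ 2 · occ true w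
  lower : ⌈ c /2⌉ ≤ occ true w
  lower = begin
    ⌈ c /2⌉                       ≤⟨ ⌈n/2⌉-mono (changes-≤-other false w) ⟩
    ⌈ occ true w + occ true w /2⌉ ≡⟨ sym (n≡⌈n+n/2⌉ _) ⟩
    occ true w                    ∎
  -- ⌊ c / 2 ⌋ ≤ occ false w, since c ≤ 1 + 2 · occ false w
  half≤falses : ⌊ c /2⌋ ≤ occ false w
  half≤falses = begin
    ⌊ c /2⌋                                 ≤⟨ ⌊n/2⌋-mono (changes-≤-same false w) ⟩
    ⌊ suc (occ false w + occ false w) /2⌋   ≡⟨ sym (n≡⌈n+n/2⌉ _) ⟩
    occ false w                             ∎
  -- n ∸ ⌈ (1 + c) / 2 ⌉ = |w| ∸ ⌊ c / 2 ⌋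
  upper : occ true w ≤ length w ∸ ⌊ c /2⌋
  upper = begin
    occ true w                                  ≤⟨ m≤n+m _ _ ⟩
    (occ false w ∸ ⌊ c /2⌋) + occ true w        ≡⟨ sym (+-∸-comm _ half≤falses) ⟩
    (occ false w + occ true w) ∸ ⌊ c /2⌋        ≡⟨ cong (_∸ ⌊ c /2⌋) (occ-length w) ⟩
    length w ∸ ⌊ c /2⌋                          ∎

-- Part (a): a permutation has distinct adjacent entries, so it inherits the bounds
-- of its descent word, which has one letter fewer than the permutation.
udr-des-bounds : ∀ n → 1 ≤ n → ∀ π → IsPerm n π → Admissible n (udr π) (des π)
udr-des-bounds .(length π) nonempty π (refl , distinct , _) =
  subst (λ n → Admissible n (udr π) (des π)) (descentWord-length π nonempty)
    (subst₂ (Admissible _) (sym (udr-descentWord π adjacent nonempty)) (sym (des-descentWord π))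
      (word-admissible (descentWord π)))
  where
  adjacent : Linked _≢_ π
  adjacent = AllPairs⇒Linked distinct

-- A permutation of 1 … |w| + 1 with descent word w: before an ascent put the
-- least value 1 and shift the rest up, before a descent put the greatest value.
realise : List Bool → List ℕ
realise [] = 1 ∷ []
realise (false ∷ w) = 1 ∷ map suc (realise w)
realise (true ∷ w) = suc (suc (length w)) ∷ realise w

realise-length : ∀ w → length (realise w) ≡ suc (length w)
realise-length [] = refl
realise-length (false ∷ w) = cong suc (trans (length-map suc (realise w)) (realise-length w))
realise-length (true ∷ w) = cong suc (realise-length w)

InRange : ℕ → ℕ → Set
InRange n x = (0 < x) × (x ≤ n)

realise-range : ∀ w → All (InRange (suc (length w))) (realise w)
realise-range [] = (s≤s z≤n , s≤s z≤n) ∷ []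
realise-range (false ∷ w) =
  (s≤s z≤n , s≤s z≤n) ∷ AllP.map⁺ (All.map (λ { (_ , x≤) → s≤s z≤n , s≤s x≤ }) (realise-range w))
realise-range (true ∷ w) =
  (s≤s z≤n , ≤-refl) ∷ All.map (λ { (0<x , x≤) → 0<x , ≤-trans x≤ (n≤1+n _) }) (realise-range w)

-- The new first value lies outside the range of the rest (after shifting).
realise-unique : ∀ w → Unique (realise w)
realise-unique [] = [] ∷ []
realise-unique (false ∷ w) =
  AllP.map⁺ (All.map (λ { (0<x , _) 1≡sx → <⇒≢ 0<x (suc-injective 1≡sx) }) (realise-range w))
  ∷ Unique.map⁺ suc-injective (realise-unique w)
realise-unique (true ∷ w) =
  All.map (λ { (_ , x≤) top≡x → <⇒≢ (s≤s x≤) (sym top≡x) }) (realise-range w)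
  ∷ realise-unique w

descentWord-map-suc : ∀ l → descentWord (map suc l) ≡ descentWord l
descentWord-map-suc [] = refl
descentWord-map-suc (x ∷ []) = refl
descentWord-map-suc (x ∷ y ∷ l) = cong ((y <ᵇ x) ∷_) (descentWord-map-suc (y ∷ l))

<⇒<ᵇ≡true : ∀ m n → m < n → (m <ᵇ n) ≡ true
<⇒<ᵇ≡true zero (suc n) _ = refl
<⇒<ᵇ≡true (suc m) (suc n) (s≤s m<n) = <⇒<ᵇ≡true m n m<n

-- The descent word of realise w is w: 1 is below every shifted value, and
-- |w| + 2 is above every value of realise w.
realise-descentWord : ∀ w → descentWord (realise w) ≡ w
realise-descentWord [] = refl
realise-descentWord (false ∷ w) with realise w | realise-descentWord w | realise-length w
... | x ∷ l | word≡w | _ = cong (false ∷_) (trans (descentWord-map-suc (x ∷ l)) word≡w)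
realise-descentWord (true ∷ w) with realise w | realise-descentWord w | realise-length w | realise-range w
... | x ∷ l | word≡w | _ | (_ , x≤) ∷ _ = cong₂ _∷_ (<⇒<ᵇ≡true x _ (s≤s x≤)) word≡w

Realisable : ℕ → ℕ → ℕ → Set
Realisable n u d = Σ (List ℕ) (λ π → IsPerm n π × (udr π ≡ u) × (des π ≡ d))

realisable-cast : ∀ {n n′ u u′ d d′} → n ≡ n′ → u ≡ u′ → d ≡ d′ →
  Realisable n u d → Realisable n′ u′ d′
realisable-cast refl refl refl realisable = realisable

word-realisable : ∀ w → Realisable (suc (length w)) (suc (changes false w)) (occ true w)
word-realisable w =
  realise w
  , (realise-length w , realise-unique w , All.map proj₁ (realise-range w))
  , trans (udr-descentWord (realise w) (AllPairs⇒Linked (realise-unique w)) nonempty)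
          (cong (suc ∘ changes false) (realise-descentWord w))
  , trans (des-descentWord (realise w)) (cong (occ true) (realise-descentWord w))
  where
  nonempty : 1 ≤ length (realise w)
  nonempty = subst (1 ≤_) (sym (realise-length w)) (s≤s z≤n)

changes-skip : ∀ p a v → changes p (replicate a p ++ v) ≡ changes p v
changes-skip p zero v = refl
changes-skip true (suc a) v = changes-skip true a v
changes-skip false (suc a) v = changes-skip false a v

occ-true-falses : ∀ a v → occ true (replicate a false ++ v) ≡ occ true v
occ-true-falses zero v = refl
occ-true-falses (suc a) v = occ-true-falses a v

occ-true-trues : ∀ e v → occ true (replicate e true ++ v) ≡ e + occ true v
occ-true-trues zero v = refl
occ-true-trues (suc e) v = cong suc (occ-true-trues e v)

alternating : Bool → ℕ → List Bool
alternating c zero = []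
alternating c (suc r) = c ∷ alternating (not c) r

length-alternating : ∀ c r → length (alternating c r) ≡ r
length-alternating c zero = refl
length-alternating c (suc r) = cong suc (length-alternating (not c) r)

changes-alternating : ∀ c r → changes (not c) (alternating c r) ≡ r
changes-alternating c zero = refl
changes-alternating false (suc r) = cong suc (changes-alternating true r)
changes-alternating true (suc r) = cong suc (changes-alternating false r)

occ-alternating : ∀ r → (occ true (alternating false r) ≡ ⌊ r /2⌋) × (occ true (alternating true r) ≡ ⌈ r /2⌉)
occ-alternating zero = refl , refl
occ-alternating (suc r) with occ-alternating r
... | falseFirst , trueFirst = trueFirst , cong suc falseFirst

-- false^a true^(e+1) followed by r alternating letters starting with false:
-- after the initial ascent it changes letter r + 1 times and has e + 1 + ⌊r/2⌋ descents.
staircase : ℕ → ℕ → ℕ → List Bool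
staircase a e r = replicate a false ++ replicate (suc e) true ++ alternating false r

staircase-length : ∀ a e r → length (staircase a e r) ≡ a + suc (e + r)
staircase-length a e r =
  trans (length-++ (replicate a false))
    (cong₂ _+_ (length-replicate a)
      (cong suc (trans (length-++ (replicate e true))
        (cong₂ _+_ (length-replicate e) (length-alternating false r)))))

staircase-changes : ∀ a e r → changes false (staircase a e r) ≡ suc r
staircase-changes a e r =
  trans (changes-skip false a _) (cong suc (trans (changes-skip true e _) (changes-alternating false r)))

staircase-occ : ∀ a e r → occ true (staircase a e r) ≡ suc (e + ⌊ r /2⌋)
staircase-occ a e r =
  trans (occ-true-falses a _) (cong suc (trans (occ-true-trues e _) (cong (e +_) (proj₁ (occ-alternating r)))))

staircase-fits : ∀ m r k e a → ⌈ r /2⌉ ≤ m → ⌊ r /2⌋ + e ≡ k → suc k + a ≡ m ∸ ⌈ r /2⌉ →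
  a + suc (e + r) ≡ m
staircase-fits m r k e a half≤m ek ak = begin
  a + suc (e + r)                       ≡⟨ cong (λ t → a + suc (e + t)) (sym (⌊n/2⌋+⌈n/2⌉≡n r)) ⟩
  a + suc (e + (⌊ r /2⌋ + ⌈ r /2⌉))     ≡⟨ cong (λ t → a + suc t) (sym (+-assoc e _ _)) ⟩
  a + suc (e + ⌊ r /2⌋ + ⌈ r /2⌉)       ≡⟨ cong (λ t → a + suc (t + ⌈ r /2⌉)) (trans (+-comm e _) ek) ⟩
  a + (suc k + ⌈ r /2⌉)                 ≡⟨ sym (+-assoc a _ _) ⟩
  a + suc k + ⌈ r /2⌉                   ≡⟨ cong (_+ ⌈ r /2⌉) (trans (+-comm a _) ak) ⟩
  m ∸ ⌈ r /2⌉ + ⌈ r /2⌉                 ≡⟨ m∸n+n≡m half≤m ⟩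
  m                                     ∎
  where open ≡-Reasoning

udr-des-realisable : ∀ n j k → 1 ≤ n → 2 ≤ j → j ≤ n → ⌊ j /2⌋ ≤ k → k ≤ n ∸ ⌈ j /2⌉ →
  Realisable n j k
udr-des-realisable (suc m) (suc (suc r)) (suc k) _ (s≤s (s≤s _)) (s≤s r<m) (s≤s half≤k) k<m∸half
  with m≤n⇒∃[o]m+o≡n half≤k | m≤n⇒∃[o]m+o≡n k<m∸half
... | e , ek | a , ak =
  realisable-cast
    (cong suc (trans (staircase-length a e r) (staircase-fits m r k e a half≤m ek ak)))
    (cong suc (staircase-changes a e r))
    (trans (staircase-occ a e r) (cong suc (trans (+-comm e _) ek)))
    (word-realisable (staircase a e r))
  where
  half≤m : ⌈ r /2⌉ ≤ m
  half≤m = ≤-trans (⌈n/2⌉≤n r) (≤-trans (n≤1+n r) r<m)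

increasing-realisable : ∀ n → 1 ≤ n → Realisable n 1 0
increasing-realisable (suc m) _ =
  realisable-cast (cong suc (length-replicate m)) (cong suc no-changes) no-descents
    (word-realisable (replicate m false))
  where
  no-changes : changes false (replicate m false) ≡ 0
  no-changes = trans (cong (changes false) (sym (++-identityʳ (replicate m false)))) (changes-skip false m [])
  no-descents : occ true (replicate m false) ≡ 0
  no-descents = trans (cong (occ true) (sym (++-identityʳ (replicate m false)))) (occ-true-falses m [])

proposition2p7 : ((n : ℕ) → 1 ≤ n → (π : List ℕ) → IsPerm n π →
       (1 ≤ udr π) × (udr π ≤ n)
       × (udr π ≡ 1 → des π ≡ 0)
       × (udr π ≢ 1 → (⌊ udr π /2⌋ ≤ des π) × (des π ≤ n ∸ ⌈ udr π /2⌉)))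
    × ((n j k : ℕ) → 1 ≤ n → 2 ≤ j → j ≤ n → ⌊ j /2⌋ ≤ k → k ≤ n ∸ ⌈ j /2⌉ →
       Σ (List ℕ) (λ π → IsPerm n π × (udr π ≡ j) × (des π ≡ k)))
    × ((n : ℕ) → 1 ≤ n →
       Σ (List ℕ) (λ π → IsPerm n π × (udr π ≡ 1) × (des π ≡ 0)))
proposition2p7 = udr-des-bounds , udr-des-realisable , increasing-realisable
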